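{- Let $d\ge1$, $k\ge1$. The number of $\mathcal D$-classes of $\wr_p^k\mathcal{IS}_d$ equals $P^k(1)$, where $P(x)=\binom{x+d}{d}$ and $P^k$ is the $k$-fold iterate of $P$.
   Context: $\mathcal{IS}_d$ is the semigroup of all injective partial maps of $N_d=\{1,\dots,d\}$ (including the empty map), written on the right, $x(ab)=(xa)b$. For a semigroup $S$, $F(N_d,S)$ is the set of functions $f$ from a subset $\mathrm{dom}(f)\subseteq N_d$ to $S$ with $\mathrm{dom}(fg)=\mathrm{dom}(f)\cap\mathrm{dom}(g)$, $(fg)(x)=f(x)g(x)$; for $a\in\mathcal{IS}_d$, $\mathrm{dom}(f^a)=\{x\in\mathrm{dom}(a):xa\in\mathrm{dom}(f)\}$, $f^a(x)=f(xa)$. $S\wr_p\mathcal{IS}_d=\{(f,a)\in F(N_d,S)\times\mathcal{IS}_d:\mathrm{dom}(f)=\mathrm{dom}(a)\}$ with $(f,a)(g,b)=(fg^a,ab)$; $\wr_p^1\mathcal{IS}_d=\mathcal{IS}_d$ and $\wr_p^k\mathcal{IS}_d=(\wr_p^{k-1}\mathcal{IS}_d)\wr_p\mathcal{IS}_d$ for $k\ge2$. $\mathcal D$ is Green's $\mathcal D$-relation. -}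

module Defs where

open import Level using (0ℓ)
open import Algebra.Bundles.Raw using (RawMagma)
open import Data.Nat using (ℕ; zero; suc; _+_)
open import Data.Nat.Combinatorics using (_C_)
open import Data.Fin using (Fin; _≟_)
open import Data.Vec using (Vec; lookup; tabulate; map)
open import Data.Vec.Properties using (lookup∘tabulate; lookup-map)
open import Data.Maybe using (Maybe; just; nothing; _>>=_)
import Data.Maybe as Maybe
import Data.Maybe.Properties as MaybeP
open import Data.Product using (Σ; ∃; ∃-syntax; _×_; _,_; proj₁; proj₂)
open import Data.Sum using (_⊎_; inj₁; inj₂)
open import Relation.Nullary using (Dec)
open import Relation.Nullary.Decidable using (True; toWitness; fromWitness; _→-dec_)
open import Relation.Binary.PropositionalEquality
  using (_≡_; refl; sym; trans; cong; subst)
import Data.Fin.Properties as FinP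

-- Partial maps of N_d = Fin d, as vectors: the i-th entry is
-- just (i a) if i ∈ dom a, and nothing otherwise.

PMap : ℕ → Set
PMap d = Vec (Maybe (Fin d)) d

Inj : ∀ {d} → PMap d → Set
Inj {d} v = ∀ (i j : Fin d) (y : Fin d) →
  lookup v i ≡ just y → lookup v j ≡ just y → i ≡ j

inj? : ∀ {d} (v : PMap d) → Dec (Inj v)
inj? {d} v = FinP.all? λ i → FinP.all? λ j → FinP.all? λ y →
  MaybeP.≡-dec _≟_ (lookup v i) (just y) →-dec
  (MaybeP.≡-dec _≟_ (lookup v j) (just y) →-dec (i ≟ j))

-- composition written on the right:  x (a b) = (x a) b
_⨾_ : ∀ {d} → PMap d → PMap d → PMap d
v ⨾ w = tabulate λ i → lookup v i >>= lookup w

private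
  bind-just : ∀ {d} (w : PMap d) (a : Maybe (Fin d)) {y} →
    (a >>= lookup w) ≡ just y → Σ (Fin d) λ m → (a ≡ just m) × (lookup w m ≡ just y)
  bind-just w (just m) p = m , refl , p

  just-inj : ∀ {A : Set} {x y : A} → just x ≡ just y → x ≡ y
  just-inj refl = refl

⨾-Inj : ∀ {d} (v w : PMap d) → Inj v → Inj w → Inj (v ⨾ w)
⨾-Inj v w iv iw i j y p q
  with bind-just w (lookup v i) (trans (sym (lookup∘tabulate _ i)) p)
     | bind-just w (lookup v j) (trans (sym (lookup∘tabulate _ j)) q)
... | m , vi , wm | m' , vj , wm' =
  iv i j m vi (subst (λ z → lookup v j ≡ just z) (sym (iw m m' y wm wm')) vj)

Inj-resp : ∀ {d} (v w : PMap d) → (∀ i → lookup v i ≡ lookup w i) → Inj v → Inj w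
Inj-resp v w e iv i j y p q = iv i j y (trans (e i) p) (trans (e j) q)

-- Injectivity is stored as a Boolean certificate, so that two elements
-- are equal iff their underlying partial maps are equal.

ISCarrier : ℕ → Set
ISCarrier d = Σ (PMap d) λ v → True (inj? v)

IS : ℕ → RawMagma 0ℓ 0ℓ
IS d = record
  { Carrier = ISCarrier d
  ; _≈_     = _≡_
  ; _∙_     = λ { (v , p) (w , q) →
      (v ⨾ w) , fromWitness (⨾-Inj v w (toWitness p) (toWitness q)) }
  }

-- An element (f , a) with dom f = dom a is encoded as the vector whose
-- i-th entry is  just (i a , f i)  if i ∈ dom a  and  nothing  otherwise.
-- Then (f,a)(g,b) = (f g^a , a b) sends i to  just ((i a) b , f(i) g(i a))
-- when i ∈ dom a and i a ∈ dom b, and is undefined otherwise.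

module _ (S : RawMagma 0ℓ 0ℓ) (d : ℕ) where
  open RawMagma S renaming (Carrier to C; _∙_ to _·_)

  WVec : Set
  WVec = Vec (Maybe (Fin d × C)) d

  shape : WVec → PMap d
  shape = map (Maybe.map proj₁)

  step : WVec → Maybe (Fin d × C) → Maybe (Fin d × C)
  step e' nothing = nothing
  step e' (just (m , s)) = Maybe.map (λ { (m' , t) → (m' , s · t) }) (lookup e' m)

  _⋆_ : WVec → WVec → WVec
  e ⋆ e' = tabulate λ i → step e' (lookup e i)

  private
    step-shape : ∀ e' (x : Maybe (Fin d × C)) →
      Maybe.map proj₁ (step e' x) ≡ (Maybe.map proj₁ x >>= lookup (shape e'))
    step-shape e' nothing = refl
    step-shape e' (just (m , s)) with lookup e' m in eq
    ... | nothing = trans refl (sym (trans (lookup-map m _ e') (cong (Maybe.map proj₁) eq)))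
    ... | just (m' , t) = sym (trans (lookup-map m _ e') (cong (Maybe.map proj₁) eq))

  shape-⋆ : ∀ e e' i → lookup (shape (e ⋆ e')) i ≡ lookup (shape e ⨾ shape e') i
  shape-⋆ e e' i =
    trans (lookup-map i _ (e ⋆ e'))
    (trans (cong (Maybe.map proj₁) (lookup∘tabulate _ i))
    (trans (step-shape e' (lookup e i))
    (trans (cong (_>>= lookup (shape e')) (sym (lookup-map i _ e)))
           (sym (lookup∘tabulate _ i)))))

  WrCarrier : Set
  WrCarrier = Σ WVec λ e → True (inj? (shape e))

  Wr : RawMagma 0ℓ 0ℓ
  Wr = record
    { Carrier = WrCarrier
    ; _≈_     = _≡_
    ; _∙_     = λ { (e , p) (e' , q) → (e ⋆ e') ,
        fromWitness (Inj-resp (shape e ⨾ shape e') (shape (e ⋆ e'))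
          (λ i → sym (shape-⋆ e e' i))
          (⨾-Inj (shape e) (shape e') (toWitness p) (toWitness q))) }
    }

-- Iterated partial wreath product:  WrPow d k = ≀_p^k IS_d  for k ≥ 1
-- (WrPow d 0 is an unused junk value, set to IS_d).
WrPow : ℕ → ℕ → RawMagma 0ℓ 0ℓ
WrPow d zero = IS d
WrPow d (suc zero) = IS d
WrPow d (suc (suc k)) = Wr (WrPow d (suc k)) d

-- Green's relations (S¹ = S with an identity adjoined).

module Green (S : RawMagma 0ℓ 0ℓ) where
  open RawMagma S renaming (Carrier to C)

  -- a ∈ S¹ b   and   a ∈ b S¹
  _≤L_ : C → C → Set
  a ≤L b = (a ≡ b) ⊎ (∃[ s ] a ≡ s ∙ b)

  _≤R_ : C → C → Set
  a ≤R b = (a ≡ b) ⊎ (∃[ s ] a ≡ b ∙ s)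

  _L_ : C → C → Set
  a L b = (a ≤L b) × (b ≤L a)

  _R_ : C → C → Set
  a R b = (a ≤R b) × (b ≤R a)

  _D_ : C → C → Set
  a D b = ∃[ c ] (a L c) × (c R b)

HasNClasses : {A : Set} → (A → A → Set) → ℕ → Set
HasNClasses {A} _~_ n =
  Σ (Vec A n) λ reps →
    (∀ i j → lookup reps i ~ lookup reps j → i ≡ j) ×
    (∀ x → ∃[ i ] x ~ lookup reps i)

NumberOfDClasses : RawMagma 0ℓ 0ℓ → ℕ → Set
NumberOfDClasses S n = HasNClasses (Green._D_ S) n

P : ℕ → ℕ → ℕ
P d x = (x + d) C d

iterate : (ℕ → ℕ) → ℕ → ℕ → ℕ
iterate f zero x = x
iterate f (suc k) x = f (iterate f k x)

-- In S ≀ IS_d an element (f , a)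
-- is classified by the multiset of classes of its labels f i, i ∈ dom a: multiplying on
-- the right keeps the domain and replaces labels by R-related ones, multiplying on the
-- left permutes the cells and replaces labels by L-related ones, and conversely a
-- class-preserving matching between the labels of x and y builds c with x L c R y.
-- Multisets of at most d elements of Fin n number C(n + d, d) = P d n, and since IS_d is
-- the wreath product of the trivial monoid with IS_d, induction on k gives P^k(1).

module Submission where

open import Defs
open import Level using (0ℓ)
open import Algebra.Bundles.Raw using (RawMagma)
open import Axiom.UniquenessOfIdentityProofs.WithK using (uip)
open import Data.Bool.Properties using (T-irrelevant)
open import Data.Empty using (⊥-elim)
open import Data.Fin as F using (Fin; zero; suc; _↑ˡ_; _↑ʳ_; splitAt)
import Data.Fin.Properties as FP
open import Data.Maybe as M using (Maybe; just; nothing; _>>=_)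
import Data.Maybe.Properties as MP
open import Data.Nat using (ℕ; zero; suc; _+_; _≤_; z≤n; s≤s)
import Data.Nat.Properties as ℕP
open import Data.Nat.Combinatorics using (_C_; nCn≡1; nCk+nC[k+1]≡[n+1]C[k+1])
open import Data.Product using (Σ; ∃; ∃-syntax; _×_; _,_; proj₁; proj₂)
open import Data.Sum using (inj₁; inj₂)
open import Data.Unit using (⊤; tt)
open import Data.Vec as V using (Vec; []; _∷_; lookup; tabulate; sum; replicate; _[_]%=_)
import Data.Vec.Properties as VP
open import Function using (id; _∘_)
open import Relation.Nullary using (Dec; yes; no)
open import Relation.Nullary.Decidable using (True; toWitness; fromWitness; dec⇒maybe)
open import Relation.Binary.PropositionalEquality

-- Vectors with bounded sum

-- v ∈ ℕⁿ with sum v ≤ d, split by whether the head of v is 0 or can be decremented.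
boundedVecs : ℕ → ℕ → ℕ
boundedVecs zero    d       = 1
boundedVecs (suc n) zero    = 1
boundedVecs (suc n) (suc d) = boundedVecs n (suc d) + boundedVecs (suc n) d

boundedVecs≡binomial : ∀ n d → boundedVecs n d ≡ (n + d) C d
boundedVecs≡binomial zero    d       = sym (nCn≡1 d)
boundedVecs≡binomial (suc n) zero    = refl
boundedVecs≡binomial (suc n) (suc d) = begin
  boundedVecs n (suc d) + boundedVecs (suc n) d
    ≡⟨ cong₂ _+_ (boundedVecs≡binomial n (suc d)) (boundedVecs≡binomial (suc n) d) ⟩
  (n + suc d) C suc d + (suc n + d) C d
    ≡⟨ cong (λ m → m C suc d + (suc n + d) C d) (ℕP.+-suc n d) ⟩
  (suc n + d) C suc d + (suc n + d) C d
    ≡⟨ ℕP.+-comm ((suc n + d) C suc d) _ ⟩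
  (suc n + d) C d + (suc n + d) C suc d
    ≡⟨ nCk+nC[k+1]≡[n+1]C[k+1] (suc n + d) d ⟩
  suc (suc n + d) C suc d
    ≡⟨ cong (λ m → suc m C suc d) (sym (ℕP.+-suc n d)) ⟩
  (suc n + suc d) C suc d ∎
  where open ≡-Reasoning

incHead : ∀ {n} → Vec ℕ (suc n) → Vec ℕ (suc n)
incHead (c ∷ cs) = suc c ∷ cs

sum-incHead : ∀ {n} (v : Vec ℕ (suc n)) → sum (incHead v) ≡ suc (sum v)
sum-incHead (c ∷ cs) = refl

sum≤0⇒replicate0 : ∀ {n} (v : Vec ℕ n) → sum v ≤ 0 → v ≡ replicate n 0
sum≤0⇒replicate0 []           _   = refl
sum≤0⇒replicate0 (zero ∷ cs) s≤0 = cong (0 ∷_) (sum≤0⇒replicate0 cs s≤0)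

sum-replicate0 : ∀ n → sum (replicate n 0) ≡ 0
sum-replicate0 zero    = refl
sum-replicate0 (suc n) = sum-replicate0 n

encode : ∀ n d (v : Vec ℕ n) → .(sum v ≤ d) → Fin (boundedVecs n d)
encode zero    d       []           _   = zero
encode (suc n) zero    _            _   = zero
encode (suc n) (suc d) (zero ∷ cs)  s≤d = encode n (suc d) cs s≤d ↑ˡ boundedVecs (suc n) d
encode (suc n) (suc d) (suc c ∷ cs) s≤d =
  boundedVecs n (suc d) ↑ʳ encode (suc n) d (c ∷ cs) (ℕP.≤-pred s≤d)

encode-incHead : ∀ n d (v : Vec ℕ (suc n)) .(s≤1+d : sum (incHead v) ≤ suc d) .(s≤d : sum v ≤ d) →
  encode (suc n) (suc d) (incHead v) s≤1+d ≡ boundedVecs n (suc d) ↑ʳ encode (suc n) d v s≤d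
encode-incHead n d (c ∷ cs) _ _ = refl

encode-cong : ∀ {n d} {v w : Vec ℕ n} → v ≡ w → .(v≤d : sum v ≤ d) .(w≤d : sum w ≤ d) →
  encode n d v v≤d ≡ encode n d w w≤d
encode-cong refl _ _ = refl

decode : ∀ n d → Fin (boundedVecs n d) → Vec ℕ n
decode zero    d       _ = []
decode (suc n) zero    _ = replicate (suc n) 0
decode (suc n) (suc d) i with splitAt (boundedVecs n (suc d)) i
... | inj₁ j = 0 ∷ decode n (suc d) j
... | inj₂ j = incHead (decode (suc n) d j)

decode-bounded : ∀ n d i → sum (decode n d i) ≤ d
decode-bounded zero    d       _ = z≤n
decode-bounded (suc n) zero    _ = ℕP.≤-reflexive (sum-replicate0 n)
decode-bounded (suc n) (suc d) i with splitAt (boundedVecs n (suc d)) i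
... | inj₁ j = decode-bounded n (suc d) j
... | inj₂ j = subst (_≤ suc d) (sym (sum-incHead (decode (suc n) d j)))
                     (s≤s (decode-bounded (suc n) d j))

encode-decode : ∀ n d i → encode n d (decode n d i) (decode-bounded n d i) ≡ i
encode-decode zero    d       zero = refl
encode-decode (suc n) zero    zero = refl
encode-decode (suc n) (suc d) i with splitAt (boundedVecs n (suc d)) i in eq
... | inj₁ j = trans (cong (_↑ˡ _) (encode-decode n (suc d) j)) (FP.splitAt⁻¹-↑ˡ eq)
... | inj₂ j = begin
  encode (suc n) (suc d) (incHead (decode (suc n) d j)) _
    ≡⟨ encode-incHead n d (decode (suc n) d j) _ (decode-bounded (suc n) d j) ⟩
  boundedVecs n (suc d) ↑ʳ encode (suc n) d (decode (suc n) d j) _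
    ≡⟨ cong (_ ↑ʳ_) (encode-decode (suc n) d j) ⟩
  boundedVecs n (suc d) ↑ʳ j
    ≡⟨ FP.splitAt⁻¹-↑ʳ eq ⟩
  i ∎
  where open ≡-Reasoning

decode-encode : ∀ n d v (v≤d : sum v ≤ d) → decode n d (encode n d v v≤d) ≡ v
decode-encode zero    d       []           _   = refl
decode-encode (suc n) zero    v            v≤0 = sym (sum≤0⇒replicate0 v v≤0)
decode-encode (suc n) (suc d) (zero ∷ cs)  v≤d
  rewrite FP.splitAt-↑ˡ (boundedVecs n (suc d)) (encode n (suc d) cs v≤d) (boundedVecs (suc n) d)
  = cong (0 ∷_) (decode-encode n (suc d) cs v≤d)
decode-encode (suc n) (suc d) (suc c ∷ cs) v≤d
  rewrite FP.splitAt-↑ʳ (boundedVecs n (suc d)) (boundedVecs (suc n) d)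
                        (encode (suc n) d (c ∷ cs) (ℕP.≤-pred v≤d))
  = cong incHead (decode-encode (suc n) d (c ∷ cs) (ℕP.≤-pred v≤d))

-- Partial colourings, occurrences and colour counts

PColouring : ℕ → ℕ → Set
PColouring n d = Vec (Maybe (Fin n)) d

module _ {n : ℕ} where

  _≟just_ : (w : Maybe (Fin n)) (z : Fin n) → Dec (w ≡ just z)
  w ≟just z = MP.≡-dec F._≟_ w (just z)

  count : ∀ {d} → Fin n → PColouring n d → ℕ
  count z = V.count (_≟just z)

  rank : ∀ {d} (g : PColouring n d) z i → lookup g i ≡ just z → Fin (count z g)
  rank (w ∷ g) z i       gi≡z with w ≟just z
  rank (w ∷ g) z zero    gi≡z | yes _   = zero
  rank (w ∷ g) z (suc i) gi≡z | yes _   = suc (rank g z i gi≡z)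
  rank (w ∷ g) z zero    gi≡z | no w≢z = ⊥-elim (w≢z gi≡z)
  rank (w ∷ g) z (suc i) gi≡z | no _    = rank g z i gi≡z

  occurrence : ∀ {d} (g : PColouring n d) z → Fin (count z g) → Fin d
  occurrence (w ∷ g) z k       with w ≟just z
  occurrence (w ∷ g) z zero    | yes _ = zero
  occurrence (w ∷ g) z (suc k) | yes _ = suc (occurrence g z k)
  occurrence (w ∷ g) z k       | no _  = suc (occurrence g z k)

  lookup-occurrence : ∀ {d} (g : PColouring n d) z k → lookup g (occurrence g z k) ≡ just z
  lookup-occurrence (w ∷ g) z k       with w ≟just z
  lookup-occurrence (w ∷ g) z zero    | yes w≡z = w≡z
  lookup-occurrence (w ∷ g) z (suc k) | yes _   = lookup-occurrence g z k
  lookup-occurrence (w ∷ g) z k       | no _    = lookup-occurrence g z k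

  occurrence-rank : ∀ {d} (g : PColouring n d) z i gi≡z → occurrence g z (rank g z i gi≡z) ≡ i
  occurrence-rank (w ∷ g) z i       gi≡z with w ≟just z
  occurrence-rank (w ∷ g) z zero    gi≡z | yes _   = refl
  occurrence-rank (w ∷ g) z (suc i) gi≡z | yes _   = cong suc (occurrence-rank g z i gi≡z)
  occurrence-rank (w ∷ g) z zero    gi≡z | no w≢z = ⊥-elim (w≢z gi≡z)
  occurrence-rank (w ∷ g) z (suc i) gi≡z | no _    = cong suc (occurrence-rank g z i gi≡z)

  rank-occurrence : ∀ {d} (g : PColouring n d) z k p → rank g z (occurrence g z k) p ≡ k
  rank-occurrence (w ∷ g) z k       p with w ≟just z
  rank-occurrence (w ∷ g) z zero    p | yes _ = refl
  rank-occurrence (w ∷ g) z (suc k) p | yes _ = cong suc (rank-occurrence g z k p)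
  rank-occurrence (w ∷ g) z k       p | no _  = rank-occurrence g z k p

  rank-cong : ∀ {d} (g : PColouring n d) z {i j} p q → i ≡ j → rank g z i p ≡ rank g z j q
  rank-cong g z p q refl = cong (rank g z _) (uip p q)

record Matching {n d : ℕ} (g h : PColouring n d) : Set where
  field
    to from     : Fin d → Fin d
    to-colour   : ∀ i {z} → lookup g i ≡ just z → lookup h (to i) ≡ just z
    from-colour : ∀ j {z} → lookup h j ≡ just z → lookup g (from j) ≡ just z
    from∘to     : ∀ i {z} → lookup g i ≡ just z → from (to i) ≡ i
    to∘from     : ∀ j {z} → lookup h j ≡ just z → to (from j) ≡ j

Matching-sym : ∀ {n d} {g h : PColouring n d} → Matching g h → Matching h g
Matching-sym M = record
  { to = from ; from = to ; to-colour = from-colour ; from-colour = to-colour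
  ; from∘to = to∘from ; to∘from = from∘to }
  where open Matching M

Matching⇒count≤ : ∀ {n d} {g h : PColouring n d} → Matching g h → ∀ z → count z g ≤ count z h
Matching⇒count≤ {g = g} {h} M z = FP.injective⇒≤ transport-injective
  where
  open Matching M
  occ-g : ∀ k → lookup g (occurrence g z k) ≡ just z
  occ-g = lookup-occurrence g z
  transport : Fin (count z g) → Fin (count z h)
  transport k = rank h z (to (occurrence g z k)) (to-colour _ (occ-g k))
  transport-injective : ∀ {k l} → transport k ≡ transport l → k ≡ l
  transport-injective {k} {l} tk≡tl = begin
    k                            ≡⟨ rank-occurrence g z k (occ-g k) ⟨
    rank g z (occurrence g z k) _ ≡⟨ rank-cong g z _ _ same-occurrence ⟩
    rank g z (occurrence g z l) _ ≡⟨ rank-occurrence g z l (occ-g l) ⟩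
    l                            ∎
    where
    open ≡-Reasoning
    same-image : to (occurrence g z k) ≡ to (occurrence g z l)
    same-image = trans (sym (occurrence-rank h z _ _))
                       (trans (cong (occurrence h z) tk≡tl) (occurrence-rank h z _ _))
    same-occurrence : occurrence g z k ≡ occurrence g z l
    same-occurrence = trans (sym (from∘to _ (occ-g k)))
                            (trans (cong from same-image) (from∘to _ (occ-g l)))

Matching⇒count≡ : ∀ {n d} {g h : PColouring n d} → Matching g h → ∀ z → count z g ≡ count z h
Matching⇒count≡ M z = ℕP.≤-antisym (Matching⇒count≤ M z) (Matching⇒count≤ (Matching-sym M) z)

-- The i-th position of colour z in g is sent to the i-th position of colour z in h.
module RankMatch {n d : ℕ} (g h : PColouring n d) (count≡ : ∀ z → count z g ≡ count z h) where

  matchAt : ∀ i w → lookup g i ≡ w → Fin d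
  matchAt i nothing  _     = i
  matchAt i (just z) gi≡z = occurrence h z (F.cast (count≡ z) (rank g z i gi≡z))

  match : Fin d → Fin d
  match i = matchAt i (lookup g i) refl

  matchAt-just : ∀ i w (gi≡w : lookup g i ≡ w) {z} (w≡z : w ≡ just z) →
    matchAt i w gi≡w ≡ occurrence h z (F.cast (count≡ z) (rank g z i (trans gi≡w w≡z)))
  matchAt-just i _ gi≡w refl = cong (λ p → occurrence h _ (F.cast (count≡ _) (rank g _ i p))) (uip _ _)

  match-just : ∀ i {z} (gi≡z : lookup g i ≡ just z) →
    match i ≡ occurrence h z (F.cast (count≡ z) (rank g z i gi≡z))
  match-just i = matchAt-just i (lookup g i) refl

  match-colour : ∀ i {z} → lookup g i ≡ just z → lookup h (match i) ≡ just z
  match-colour i {z} gi≡z = subst (λ j → lookup h j ≡ just z) (sym (match-just i gi≡z)) (lookup-occurrence h z _)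

match-inverse : ∀ {n d} (g h : PColouring n d) count≡ count≡′ i {z} → lookup g i ≡ just z →
  RankMatch.match h g count≡′ (RankMatch.match g h count≡ i) ≡ i
match-inverse g h count≡ count≡′ i {z} gi≡z = begin
  match′ (match i)                                              ≡⟨ cong match′ (match-just i gi≡z) ⟩
  match′ (occurrence h z k)                                     ≡⟨ match′-just _ (lookup-occurrence h z k) ⟩
  occurrence g z (F.cast (count≡′ z) (rank h z (occurrence h z k) _))
    ≡⟨ cong (λ r → occurrence g z (F.cast (count≡′ z) r)) (rank-occurrence h z k _) ⟩
  occurrence g z (F.cast (count≡′ z) k)
    ≡⟨ cong (occurrence g z) (FP.cast-involutive (count≡′ z) (count≡ z) _) ⟩
  occurrence g z (rank g z i gi≡z)                              ≡⟨ occurrence-rank g z i gi≡z ⟩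
  i                                                             ∎
  where
  open ≡-Reasoning
  open RankMatch g h count≡
  open RankMatch h g count≡′ renaming (match to match′; match-just to match′-just) using ()
  k = F.cast (count≡ z) (rank g z i gi≡z)

count≡⇒Matching : ∀ {n d} (g h : PColouring n d) → (∀ z → count z g ≡ count z h) → Matching g h
count≡⇒Matching g h count≡ = record
  { to = RankMatch.match g h count≡
  ; from = RankMatch.match h g count≡′
  ; to-colour = RankMatch.match-colour g h count≡
  ; from-colour = RankMatch.match-colour h g count≡′
  ; from∘to = match-inverse g h count≡ count≡′
  ; to∘from = match-inverse h g count≡′ count≡ }
  where
  count≡′ : ∀ z → count z h ≡ count z g
  count≡′ z = sym (count≡ z)

counts : ∀ {n d} → PColouring n d → Vec ℕ n
counts {n} []             = replicate n 0
counts     (nothing ∷ g) = counts g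
counts     (just z ∷ g)  = counts g [ z ]%= suc

lookup-counts : ∀ {n d} (g : PColouring n d) z → lookup (counts g) z ≡ count z g
lookup-counts []      z = VP.lookup-replicate z 0
lookup-counts (w ∷ g) z with w ≟just z
lookup-counts (just z ∷ g)  z | yes refl = trans (VP.lookup∘updateAt z (counts g)) (cong suc (lookup-counts g z))
lookup-counts (nothing ∷ g) z | no _     = lookup-counts g z
lookup-counts (just y ∷ g)  z | no y≢z  =
  trans (VP.lookup∘updateAt′ z y (λ z≡y → y≢z (cong just (sym z≡y))) (counts g)) (lookup-counts g z)

sum-inc : ∀ {n} (v : Vec ℕ n) z → sum (v [ z ]%= suc) ≡ suc (sum v)
sum-inc (c ∷ v) zero    = refl
sum-inc (c ∷ v) (suc z) = trans (cong (c +_) (sum-inc v z)) (ℕP.+-suc c (sum v))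

sum-counts≤ : ∀ {n d} (g : PColouring n d) → sum (counts g) ≤ d
sum-counts≤ {n} []         = ℕP.≤-reflexive (sum-replicate0 n)
sum-counts≤ (nothing ∷ g) = ℕP.m≤n⇒m≤1+n (sum-counts≤ g)
sum-counts≤ (just z ∷ g)  = subst (_≤ _) (sym (sum-inc (counts g) z)) (s≤s (sum-counts≤ g))

realise : ∀ n d → Vec ℕ n → PColouring n d
realise n       zero    _            = []
realise zero    (suc d) []           = nothing ∷ realise zero d []
realise (suc n) (suc d) (zero ∷ cs)  = V.map (M.map suc) (realise n (suc d) cs)
realise (suc n) (suc d) (suc c ∷ cs) = just zero ∷ realise (suc n) d (c ∷ cs)

counts-map-suc : ∀ {n d} (g : PColouring n d) → counts (V.map (M.map suc) g) ≡ 0 ∷ counts g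
counts-map-suc []            = refl
counts-map-suc (nothing ∷ g) = counts-map-suc g
counts-map-suc (just z ∷ g)  = cong (_[ suc z ]%= suc) (counts-map-suc g)

counts-realise : ∀ n d (v : Vec ℕ n) → sum v ≤ d → counts (realise n d v) ≡ v
counts-realise zero    d       []           _   = empty (counts (realise zero d []))
  where
  empty : (v : Vec ℕ 0) → v ≡ []
  empty [] = refl
counts-realise (suc n) zero    v            v≤0 = sym (sum≤0⇒replicate0 v v≤0)
counts-realise (suc n) (suc d) (zero ∷ cs)  v≤d =
  trans (counts-map-suc (realise n (suc d) cs)) (cong (0 ∷_) (counts-realise n (suc d) cs v≤d))
counts-realise (suc n) (suc d) (suc c ∷ cs) v≤d =
  cong (_[ zero ]%= suc) (counts-realise (suc n) d (c ∷ cs) (ℕP.≤-pred v≤d))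

Σ-True-≡ : ∀ {A : Set} {P : A → Set} (P? : ∀ a → Dec (P a)) {x y : Σ A (λ a → True (P? a))} →
  proj₁ x ≡ proj₁ y → x ≡ y
Σ-True-≡ _ {a , p} {.a , q} refl = cong (a ,_) (T-irrelevant p q)

lookup-ext : ∀ {A : Set} {k} {xs ys : Vec A k} → (∀ i → lookup xs i ≡ lookup ys i) → xs ≡ ys
lookup-ext {xs = xs} {ys} xs≗ys =
  trans (sym (VP.tabulate∘lookup xs)) (trans (VP.tabulate-cong xs≗ys) (VP.tabulate∘lookup ys))

-- target v i = i off the domain of v.
target : ∀ {d} → PMap d → Fin d → Fin d
target v i = M.maybe id i (lookup v i)

target-just : ∀ {d} (v : PMap d) {i m} → lookup v i ≡ just m → target v i ≡ m
target-just v {i} vi≡m = cong (M.maybe id i) vi≡m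

Inj-fromLeftInverse : ∀ {d} (v : PMap d) (u : Fin d → Fin d) →
  (∀ i {m} → lookup v i ≡ just m → u m ≡ i) → Inj v
Inj-fromLeftInverse v u u∘v≗id i j _ vi≡y vj≡y = trans (sym (u∘v≗id i vi≡y)) (u∘v≗id j vj≡y)

idMap : ∀ {d} → PMap d
idMap = tabulate just

lookup-idMap : ∀ {d} (i : Fin d) → lookup idMap i ≡ just i
lookup-idMap = VP.lookup∘tabulate just

module _ {d : ℕ} (v : PMap d) where

  preimage : ∀ m → Dec (∃[ i ] lookup v i ≡ just m)
  preimage m = FP.any? (λ i → lookup v i ≟just m)

  inverseAt : Fin d → Maybe (Fin d)
  inverseAt m = M.map proj₁ (dec⇒maybe (preimage m))

  inverse : PMap d
  inverse = tabulate inverseAt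

  lookup-inverse⇒ : ∀ {m i} → lookup inverse m ≡ just i → lookup v i ≡ just m
  lookup-inverse⇒ {m} inv-m≡i = sound (preimage m) (trans (sym (VP.lookup∘tabulate inverseAt m)) inv-m≡i)
    where
    sound : ∀ {i} (pre : Dec (∃[ i ] lookup v i ≡ just m)) → M.map proj₁ (dec⇒maybe pre) ≡ just i →
      lookup v i ≡ just m
    sound (yes (_ , vi≡m)) refl = vi≡m
    sound (no _)           ()

  lookup-inverse : Inj v → ∀ {i m} → lookup v i ≡ just m → lookup inverse m ≡ just i
  lookup-inverse v-inj {i} {m} vi≡m = trans (VP.lookup∘tabulate inverseAt m) (complete (preimage m))
    where
    complete : (pre : Dec (∃[ i ] lookup v i ≡ just m)) → M.map proj₁ (dec⇒maybe pre) ≡ just i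
    complete (yes (j , vj≡m)) = cong just (v-inj j i m vj≡m vi≡m)
    complete (no ¬pre)        = ⊥-elim (¬pre (i , vi≡m))

map≡just⇒ : ∀ {A B : Set} {g : A → B} (w : Maybe A) {b} →
  M.map g w ≡ just b → ∃[ a ] (w ≡ just a) × (g a ≡ b)
map≡just⇒ (just a) refl = a , refl , refl

restrict : ∀ {A : Set} {d} → (Fin d → Fin d) → Vec (Maybe A) d → PMap d
restrict f w = tabulate λ i → M.map (λ _ → f i) (lookup w i)

lookup-restrict : ∀ {A : Set} {d} (f : Fin d → Fin d) (w : Vec (Maybe A) d) i →
  lookup (restrict f w) i ≡ M.map (λ _ → f i) (lookup w i)
lookup-restrict f w i = VP.lookup∘tabulate _ i

lookup-restrict-just : ∀ {A : Set} {d} (f : Fin d → Fin d) (w : Vec (Maybe A) d) i {a} →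
  lookup w i ≡ just a → lookup (restrict f w) i ≡ just (f i)
lookup-restrict-just f w i wi≡a = trans (lookup-restrict f w i) (MP.map-just wi≡a)

lookup-restrict-nothing : ∀ {A : Set} {d} (f : Fin d → Fin d) (w : Vec (Maybe A) d) i →
  lookup w i ≡ nothing → lookup (restrict f w) i ≡ nothing
lookup-restrict-nothing f w i wi≡∅ = trans (lookup-restrict f w i) (MP.map-nothing wi≡∅)

Inj-restrict : ∀ {A : Set} {d} (f u : Fin d → Fin d) (w : Vec (Maybe A) d) →
  (∀ i {a} → lookup w i ≡ just a → u (f i) ≡ i) → Inj (restrict f w)
Inj-restrict f u w u∘f≗id = Inj-fromLeftInverse (restrict f w) u λ i fi≡m →
  let _ , wi≡a , fi≡m = map≡just⇒ (lookup w i) (trans (sym (lookup-restrict f w i)) fi≡m)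
  in trans (cong u (sym fi≡m)) (u∘f≗id i wi≡a)

lookup-restrict⇒ : ∀ {A : Set} {d} (f : Fin d → Fin d) (w : Vec (Maybe A) d) i {m} →
  lookup (restrict f w) i ≡ just m → ∃[ a ] lookup w i ≡ just a
lookup-restrict⇒ f w i fi≡m =
  let a , wi≡a , _ = map≡just⇒ (lookup w i) (trans (sym (lookup-restrict f w i)) fi≡m) in a , wi≡a

lookup-⨾ : ∀ {d} (v w : PMap d) i → lookup (v ⨾ w) i ≡ (lookup v i >>= lookup w)
lookup-⨾ v w i = VP.lookup∘tabulate _ i

by-domain : ∀ {A B : Set} {d} (w : Vec (Maybe A) d) {p q : Fin d → B} →
  (∀ i → lookup w i ≡ nothing → p i ≡ q i) → (∀ i {a} → lookup w i ≡ just a → p i ≡ q i) →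
  ∀ i → p i ≡ q i
by-domain w off on i with lookup w i in wi
... | nothing = off i wi
... | just _  = on i wi

-- D-classifications

module Multiples (S : RawMagma 0ℓ 0ℓ) where
  open RawMagma S

  _≼L_ : Carrier → Carrier → Set
  a ≼L b = ∃[ s ] a ≡ s ∙ b

  _≼R_ : Carrier → Carrier → Set
  a ≼R b = ∃[ s ] a ≡ b ∙ s

-- S is a monoid, so Green's relations on S need no adjoined identity.
record DClassification (S : RawMagma 0ℓ 0ℓ) (n : ℕ) : Set where
  open RawMagma S renaming (Carrier to C; _∙_ to _·_)
  open Multiples S
  field
    one       : C
    identityˡ : ∀ a → one · a ≡ a
    identityʳ : ∀ a → a · one ≡ a
    class     : C → Fin n
    rep       : Fin n → C
    class-rep : ∀ i → class (rep i) ≡ i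
    class-L   : ∀ {a b} → a ≼L b → b ≼L a → class a ≡ class b
    class-R   : ∀ {a b} → a ≼R b → b ≼R a → class a ≡ class b
    class≡⇒LR : ∀ {a b} → class a ≡ class b → ∃[ c ] (a ≼L c × c ≼L a) × (c ≼R b × b ≼R c)

module _ {S : RawMagma 0ℓ 0ℓ} {n : ℕ} (𝒞 : DClassification S n) where
  open RawMagma S renaming (Carrier to C)
  open DClassification 𝒞
  open Multiples S
  open Green S

  ≤L⇒≼L : ∀ {a b} → a ≤L b → a ≼L b
  ≤L⇒≼L (inj₁ refl) = one , sym (identityˡ _)
  ≤L⇒≼L (inj₂ a≼b)  = a≼b

  ≤R⇒≼R : ∀ {a b} → a ≤R b → a ≼R b
  ≤R⇒≼R (inj₁ refl) = one , sym (identityʳ _)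
  ≤R⇒≼R (inj₂ a≼b)  = a≼b

  D⇒class≡ : ∀ {a b} → a D b → class a ≡ class b
  D⇒class≡ (c , (a≤c , c≤a) , (c≤b , b≤c)) =
    trans (class-L (≤L⇒≼L a≤c) (≤L⇒≼L c≤a)) (class-R (≤R⇒≼R c≤b) (≤R⇒≼R b≤c))

  class≡⇒D : ∀ {a b} → class a ≡ class b → a D b
  class≡⇒D a~b with class≡⇒LR a~b
  ... | c , (a≼c , c≼a) , (c≼b , b≼c) = c , (inj₂ a≼c , inj₂ c≼a) , (inj₂ c≼b , inj₂ b≼c)

  DClassification⇒NumberOfDClasses : NumberOfDClasses S n
  DClassification⇒NumberOfDClasses = tabulate rep , distinct , cover
    where
    rep-lookup : ∀ i → lookup (tabulate rep) i ≡ rep i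
    rep-lookup = VP.lookup∘tabulate rep
    distinct : ∀ i j → lookup (tabulate rep) i D lookup (tabulate rep) j → i ≡ j
    distinct i j ri~rj rewrite rep-lookup i | rep-lookup j =
      trans (sym (class-rep i)) (trans (D⇒class≡ ri~rj) (class-rep j))
    cover : ∀ a → ∃[ i ] a D lookup (tabulate rep) i
    cover a = class a , subst (a D_) (sym (rep-lookup (class a))) (class≡⇒D (sym (class-rep (class a))))

module Bridges {S : RawMagma 0ℓ 0ℓ} {n : ℕ} (𝒞 : DClassification S n) where
  open RawMagma S renaming (Carrier to C; _∙_ to _·_)
  open DClassification 𝒞

  record Bridge (a b : C) : Set where
    field
      mid α β γ δ : C
      a≡α·mid : a ≡ α · mid
      mid≡β·a : mid ≡ β · a
      mid≡b·γ : mid ≡ b · γ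
      b≡mid·δ : b ≡ mid · δ

  bridge : ∀ {a b} → class a ≡ class b → Bridge a b
  bridge a~b with class≡⇒LR a~b
  ... | c , ((α , a≡αc) , (β , c≡βa)) , ((γ , c≡bγ) , (δ , b≡cδ)) = record
    { mid = c ; α = α ; β = β ; γ = γ ; δ = δ
    ; a≡α·mid = a≡αc ; mid≡β·a = c≡βa ; mid≡b·γ = c≡bγ ; b≡mid·δ = b≡cδ }

  bridge? : ∀ a b → Maybe (Bridge a b)
  bridge? a b = M.map bridge (dec⇒maybe (class a F.≟ class b))

  bridge?-just : ∀ {a b} → class a ≡ class b → ∃[ B ] bridge? a b ≡ just B
  bridge?-just {a} {b} a~b with class a F.≟ class b
  ... | yes a~b′ = bridge a~b′ , refl
  ... | no a≁b   = ⊥-elim (a≁b a~b)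

module Transport {S₁ S₂ : RawMagma 0ℓ 0ℓ} {n : ℕ} (𝒞 : DClassification S₂ n)
  (to : RawMagma.Carrier S₁ → RawMagma.Carrier S₂) (from : RawMagma.Carrier S₂ → RawMagma.Carrier S₁)
  (from∘to : ∀ a → from (to a) ≡ a) (to∘from : ∀ b → to (from b) ≡ b)
  (from-hom : ∀ a b → from (RawMagma._∙_ S₂ a b) ≡ RawMagma._∙_ S₁ (from a) (from b)) where

  open RawMagma S₁ renaming (Carrier to C₁; _∙_ to _·₁_)
  open RawMagma S₂ renaming (Carrier to C₂; _∙_ to _·₂_)
  open DClassification 𝒞

  to-hom : ∀ a b → to (a ·₁ b) ≡ to a ·₂ to b
  to-hom a b = begin
    to (a ·₁ b)                   ≡⟨ cong to (cong₂ _·₁_ (from∘to a) (from∘to b)) ⟨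
    to (from (to a) ·₁ from (to b)) ≡⟨ cong to (from-hom (to a) (to b)) ⟨
    to (from (to a ·₂ to b))       ≡⟨ to∘from _ ⟩
    to a ·₂ to b                  ∎
    where open ≡-Reasoning

  from-≡ : ∀ {a s b} → a ≡ s ·₂ b → from a ≡ from s ·₁ from b
  from-≡ refl = from-hom _ _

  transported : DClassification S₁ n
  transported = record
    { one       = from one
    ; identityˡ = λ a → subst (λ z → from one ·₁ z ≡ z) (from∘to a) (sym (from-≡ (sym (identityˡ (to a)))))
    ; identityʳ = λ a → subst (λ z → z ·₁ from one ≡ z) (from∘to a) (sym (from-≡ (sym (identityʳ (to a)))))
    ; class     = class ∘ to
    ; rep       = from ∘ rep
    ; class-rep = λ i → trans (cong class (to∘from (rep i))) (class-rep i)
    ; class-L   = λ { (s , a≡sb) (s′ , b≡s′a) →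
        class-L (to s , trans (cong to a≡sb) (to-hom s _)) (to s′ , trans (cong to b≡s′a) (to-hom s′ _)) }
    ; class-R   = λ { (s , a≡bs) (s′ , b≡as′) →
        class-R (to s , trans (cong to a≡bs) (to-hom _ s)) (to s′ , trans (cong to b≡as′) (to-hom _ s′)) }
    ; class≡⇒LR = λ {a} {b} a~b →
        let c , ((s₁ , a≡s₁c) , (s₂ , c≡s₂a)) , ((s₃ , c≡bs₃) , (s₄ , b≡cs₄)) = class≡⇒LR a~b
        in from c , ((from s₁ , trans (sym (from∘to a)) (from-≡ a≡s₁c))
                   , (from s₂ , trans (from-≡ c≡s₂a) (cong (from s₂ ·₁_) (from∘to a))))
                  , ((from s₃ , trans (from-≡ c≡bs₃) (cong (_·₁ from s₃) (from∘to b)))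
                   , (from s₄ , trans (sym (from∘to b)) (from-≡ b≡cs₄))) }

-- The D-classes of a partial wreath product

module WreathClassification {S : RawMagma 0ℓ 0ℓ} {n : ℕ} (𝒞 : DClassification S n) (d : ℕ) where
  open RawMagma S renaming (Carrier to C; _∙_ to _·_)
  open DClassification 𝒞
  open Bridges 𝒞
  open RawMagma (Wr S d) using () renaming (Carrier to W; _∙_ to _⊙_)
  open Multiples (Wr S d)

  Cells : Set
  Cells = WVec S d

  shape′ : Cells → PMap d
  shape′ = shape S d

  step′ : Cells → Maybe (Fin d × C) → Maybe (Fin d × C)
  step′ = step S d

  _⋆′_ : Cells → Cells → Cells
  _⋆′_ = _⋆_ S d

  lookup-⋆ : ∀ {e} a b → e ≡ a ⋆′ b → ∀ i → lookup e i ≡ step′ b (lookup a i)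
  lookup-⋆ a b refl i = VP.lookup∘tabulate _ i

  lookup-shape : ∀ e i → lookup (shape′ e) i ≡ M.map proj₁ (lookup e i)
  lookup-shape e i = VP.lookup-map i _ e

  W-≡ : ∀ {x y : W} → proj₁ x ≡ proj₁ y → x ≡ y
  W-≡ = Σ-True-≡ (inj? ∘ shape′)

  assemble : PMap d → (Fin d → C) → Cells
  assemble v l = tabulate λ i → M.map (_, l i) (lookup v i)

  label : Cells → Fin d → C
  label e i = M.maybe proj₂ one (lookup e i)

  lookup-assemble : ∀ v l i → lookup (assemble v l) i ≡ M.map (_, l i) (lookup v i)
  lookup-assemble v l i = VP.lookup∘tabulate _ i

  assemble-shape-label : ∀ e → e ≡ assemble (shape′ e) (label e)
  assemble-shape-label e = lookup-ext λ i → begin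
    lookup e i                                        ≡⟨ cell (lookup e i) ⟩
    M.map (_, label e i) (M.map proj₁ (lookup e i))  ≡⟨ cong (M.map _) (lookup-shape e i) ⟨
    M.map (_, label e i) (lookup (shape′ e) i)       ≡⟨ lookup-assemble (shape′ e) (label e) i ⟨
    lookup (assemble (shape′ e) (label e)) i          ∎
    where
    open ≡-Reasoning
    cell : ∀ w → w ≡ M.map (_, M.maybe proj₂ one w) (M.map proj₁ w)
    cell nothing  = refl
    cell (just _) = refl

  lookup-shape-assemble : ∀ v l i → lookup (shape′ (assemble v l)) i ≡ lookup v i
  lookup-shape-assemble v l i =
    trans (lookup-shape (assemble v l) i) (trans (cong (M.map proj₁) (lookup-assemble v l i)) (forget (lookup v i)))
    where
    forget : ∀ w → M.map proj₁ (M.map (_, l i) w) ≡ w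
    forget nothing  = refl
    forget (just _) = refl

  assemble-⋆ : ∀ v l w l′ → assemble v l ⋆′ assemble w l′ ≡ assemble (v ⨾ w) (λ i → l i · l′ (target v i))
  assemble-⋆ v l w l′ = lookup-ext λ i → begin
    lookup (assemble v l ⋆′ assemble w l′) i            ≡⟨ lookup-⋆ (assemble v l) (assemble w l′) refl i ⟩
    step′ (assemble w l′) (lookup (assemble v l) i)    ≡⟨ cong (step′ (assemble w l′)) (lookup-assemble v l i) ⟩
    step′ (assemble w l′) (M.map (_, l i) (lookup v i)) ≡⟨ cell (lookup v i) refl ⟩
    M.map (_, l i · l′ (target v i)) (lookup v i >>= lookup w)
      ≡⟨ cong (M.map _) (VP.lookup∘tabulate _ i) ⟨
    M.map (_, l i · l′ (target v i)) (lookup (v ⨾ w) i) ≡⟨ lookup-assemble (v ⨾ w) _ i ⟨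
    lookup (assemble (v ⨾ w) _) i                       ∎
    where
    open ≡-Reasoning
    cell : ∀ {i} a → lookup v i ≡ a → step′ (assemble w l′) (M.map (_, l i) a) ≡
           M.map (_, l i · l′ (target v i)) (a >>= lookup w)
    cell nothing         _    = refl
    cell {i} (just m) vi≡m rewrite lookup-assemble w l′ m | vi≡m with lookup w m
    ... | nothing = refl
    ... | just _  = refl

  assemble-cong : ∀ v v′ {l l′} → (∀ i → lookup v i ≡ lookup v′ i) →
    (∀ i {m} → lookup v i ≡ just m → l i ≡ l′ i) → assemble v l ≡ assemble v′ l′
  assemble-cong v v′ {l} {l′} v≗v′ l≗l′ = lookup-ext λ i →
    trans (lookup-assemble v l i) (trans (cell i (lookup v i) refl) (sym (lookup-assemble v′ l′ i)))
    where
    cell : ∀ i w → lookup v i ≡ w → M.map (_, l i) w ≡ M.map (_, l′ i) (lookup v′ i)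
    cell i nothing  vi≡w rewrite sym (v≗v′ i) | vi≡w = refl
    cell i (just m) vi≡w rewrite sym (v≗v′ i) | vi≡w | l≗l′ i vi≡w = refl

  element : (v : PMap d) → (Fin d → C) → Inj v → W
  element v l v-inj = assemble v l ,
    fromWitness (Inj-resp v (shape′ (assemble v l)) (λ i → sym (lookup-shape-assemble v l i)) v-inj)

  unit : W
  unit = element idMap (λ _ → one)
    (Inj-fromLeftInverse idMap id λ i idi≡m → sym (MP.just-injective (trans (sym (lookup-idMap i)) idi≡m)))

  unit-identityˡ : ∀ x → unit ⊙ x ≡ x
  unit-identityˡ (e , _) = W-≡ (begin
    assemble idMap (λ _ → one) ⋆′ e
      ≡⟨ cong (assemble idMap (λ _ → one) ⋆′_) (assemble-shape-label e) ⟩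
    assemble idMap (λ _ → one) ⋆′ assemble (shape′ e) (label e)
      ≡⟨ assemble-⋆ idMap _ (shape′ e) (label e) ⟩
    assemble (idMap ⨾ shape′ e) (λ i → one · label e (target idMap i))
      ≡⟨ assemble-cong (idMap ⨾ shape′ e) (shape′ e) same-shape same-label ⟩
    assemble (shape′ e) (label e)
      ≡⟨ assemble-shape-label e ⟨
    e ∎)
    where
    open ≡-Reasoning
    same-shape : ∀ i → lookup (idMap ⨾ shape′ e) i ≡ lookup (shape′ e) i
    same-shape i = trans (VP.lookup∘tabulate _ i) (cong (_>>= lookup (shape′ e)) (lookup-idMap i))
    same-label : ∀ i {m} → lookup (idMap ⨾ shape′ e) i ≡ just m → one · label e (target idMap i) ≡ label e i
    same-label i _ = trans (identityˡ _) (cong (label e) (target-just idMap (lookup-idMap i)))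

  unit-identityʳ : ∀ x → x ⊙ unit ≡ x
  unit-identityʳ (e , _) = W-≡ (begin
    e ⋆′ assemble idMap (λ _ → one)
      ≡⟨ cong (_⋆′ assemble idMap (λ _ → one)) (assemble-shape-label e) ⟩
    assemble (shape′ e) (label e) ⋆′ assemble idMap (λ _ → one)
      ≡⟨ assemble-⋆ (shape′ e) (label e) idMap _ ⟩
    assemble (shape′ e ⨾ idMap) (λ i → label e i · one)
      ≡⟨ assemble-cong (shape′ e ⨾ idMap) (shape′ e) same-shape (λ i _ → identityʳ _) ⟩
    assemble (shape′ e) (label e)
      ≡⟨ assemble-shape-label e ⟨
    e ∎)
    where
    open ≡-Reasoning
    after-id : ∀ w → (w >>= lookup idMap) ≡ w
    after-id nothing  = refl
    after-id (just m) = lookup-idMap m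
    same-shape : ∀ i → lookup (shape′ e ⨾ idMap) i ≡ lookup (shape′ e) i
    same-shape i = trans (VP.lookup∘tabulate _ i) (after-id (lookup (shape′ e) i))

  cellClass : Maybe (Fin d × C) → Maybe (Fin n)
  cellClass = M.map (class ∘ proj₂)

  classes : W → PColouring n d
  classes x = tabulate (cellClass ∘ lookup (proj₁ x))

  lookup-classes : ∀ x i → lookup (classes x) i ≡ cellClass (lookup (proj₁ x) i)
  lookup-classes x = VP.lookup∘tabulate _

  classW : W → Fin (boundedVecs n d)
  classW x = encode n d (counts (classes x)) (sum-counts≤ (classes x))

  count≡⇒classW≡ : ∀ x y → (∀ z → count z (classes x) ≡ count z (classes y)) → classW x ≡ classW y
  count≡⇒classW≡ x y count≡ = encode-cong (lookup-ext λ z →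
    trans (lookup-counts (classes x) z) (trans (count≡ z) (sym (lookup-counts (classes y) z)))) _ _

  classW≡⇒count≡ : ∀ x y → classW x ≡ classW y → ∀ z → count z (classes x) ≡ count z (classes y)
  classW≡⇒count≡ x y x~y z = begin
    count z (classes x)          ≡⟨ lookup-counts (classes x) z ⟨
    lookup (counts (classes x)) z ≡⟨ cong (λ v → lookup v z) same-counts ⟩
    lookup (counts (classes y)) z ≡⟨ lookup-counts (classes y) z ⟩
    count z (classes y)          ∎
    where
    open ≡-Reasoning
    same-counts : counts (classes x) ≡ counts (classes y)
    same-counts = trans (sym (decode-encode n d _ (sum-counts≤ (classes x))))
                        (trans (cong (decode n d) x~y) (decode-encode n d _ (sum-counts≤ (classes y))))

  lookup-shape-just : ∀ e i {m s} → lookup e i ≡ just (m , s) → lookup (shape′ e) i ≡ just m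
  lookup-shape-just e i ei≡ms = trans (lookup-shape e i) (cong (M.map proj₁) ei≡ms)

  cellClass-just : ∀ w {a} → cellClass w ≡ just a → ∃[ m ] ∃[ s ] (w ≡ just (m , s)) × (class s ≡ a)
  cellClass-just (just (m , s)) refl = m , s , refl , refl

  step-just : ∀ t w {m′ s′} → step′ t w ≡ just (m′ , s′) →
    ∃[ m ] ∃[ s ] ∃[ s₀ ] (w ≡ just (m , s)) × (lookup t m ≡ just (m′ , s₀)) × (s′ ≡ s · s₀)
  step-just t (just (m , s)) tw≡ with lookup t m in tm
  ... | just (m′ , s₀) with refl ← tw≡ = m , s , s₀ , refl , tm , refl

  cellClass-R : ∀ a b (t t′ : Cells) → a ≡ step′ t b → b ≡ step′ t′ a → cellClass a ≡ cellClass b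
  cellClass-R a nothing        t t′ refl _ = refl
  cellClass-R a (just (m , s)) t t′ a≡bt b≡at′
    with step-just t′ a (sym b≡at′)
  ... | _ , s₁ , _ , a≡s₁ , _ , s≡s₁s₀
    with step-just t (just (m , s)) (trans (sym a≡bt) a≡s₁)
  ... | _ , _ , _ , refl , _ , s₁≡ss₀ =
    trans (cong cellClass a≡s₁) (cong just (class-R (_ , s₁≡ss₀) (_ , s≡s₁s₀)))

  classW-R : ∀ {x c} → x ≼R c → c ≼R x → classW x ≡ classW c
  classW-R {x} {c} (t , x≡ct) (t′ , c≡xt′) = count≡⇒classW≡ x c λ z → cong (count z) same-classes
    where
    open ≡-Reasoning
    same-classes : classes x ≡ classes c
    same-classes = lookup-ext λ i → begin
      lookup (classes x) i           ≡⟨ lookup-classes x i ⟩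
      cellClass (lookup (proj₁ x) i) ≡⟨ cellClass-R _ _ (proj₁ t) (proj₁ t′)
                                          (lookup-⋆ (proj₁ c) (proj₁ t) (cong proj₁ x≡ct) i)
                                          (lookup-⋆ (proj₁ x) (proj₁ t′) (cong proj₁ c≡xt′) i) ⟩
      cellClass (lookup (proj₁ c) i) ≡⟨ lookup-classes c i ⟨
      lookup (classes c) i           ∎

  -- In x = u c and c = v x, the cell of x at i is the product of a label of u and the cell of c at i u,
  -- which in turn comes from the cell of x at (i u) v = i, by injectivity of the shape of x.
  cellClass-L : ∀ (ex ec eu ev : Cells) → Inj (shape′ ex) →
    (∀ i → lookup ex i ≡ step′ ec (lookup eu i)) → (∀ m → lookup ec m ≡ step′ ex (lookup ev m)) →
    ∀ i {a} → cellClass (lookup ex i) ≡ just a →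
    cellClass (lookup ec (target (shape′ eu) i)) ≡ just a × target (shape′ ev) (target (shape′ eu) i) ≡ i
  cellClass-L ex ec eu ev ex-inj x≡uc c≡vx i x-class
    with cellClass-just (lookup ex i) x-class
  ... | mx , sx , xi , sx~a
    with step-just ec (lookup eu i) (trans (sym (x≡uc i)) xi)
  ... | m , α , sc , ui , cm , sx≡αsc
    with step-just ex (lookup ev m) (trans (sym (c≡vx m)) cm)
  ... | i′ , β , sx′ , vm , xi′ , sc≡βsx′ = c-class , v-target
    where
    i′≡i : i′ ≡ i
    i′≡i = ex-inj i′ i mx (lookup-shape-just ex i′ xi′) (lookup-shape-just ex i xi)
    sx′≡sx : sx′ ≡ sx
    sx′≡sx = cong proj₂ (MP.just-injective (trans (sym xi′) (trans (cong (lookup ex) i′≡i) xi)))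
    u-target : target (shape′ eu) i ≡ m
    u-target = target-just (shape′ eu) (lookup-shape-just eu i ui)
    c-class : cellClass (lookup ec (target (shape′ eu) i)) ≡ just _
    sc~sx : class sc ≡ class sx
    sc~sx = sym (class-L (α , sx≡αsc) (β , trans sc≡βsx′ (cong (β ·_) sx′≡sx)))
    c-class = trans (cong (cellClass ∘ lookup ec) u-target) (trans (cong cellClass cm) (cong just (trans sc~sx sx~a)))
    v-target : target (shape′ ev) (target (shape′ eu) i) ≡ i
    v-target = trans (cong (target (shape′ ev)) u-target)
                     (trans (target-just (shape′ ev) (lookup-shape-just ev m vm)) i′≡i)

  lookup-classes⇒cellClass : ∀ x i {a} → lookup (classes x) i ≡ just a → cellClass (lookup (proj₁ x) i) ≡ just a
  lookup-classes⇒cellClass x i xi≡a = trans (sym (lookup-classes x i)) xi≡a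

  L-matching : ∀ {x c} → x ≼L c → c ≼L x → Matching (classes x) (classes c)
  L-matching {x} {c} (u , x≡uc) (v , c≡vx) = record
    { to          = target (shape′ (proj₁ u))
    ; from        = target (shape′ (proj₁ v))
    ; to-colour   = λ i xi≡a → trans (lookup-classes c _) (proj₁ (x→c i xi≡a))
    ; from-colour = λ j cj≡a → trans (lookup-classes x _) (proj₁ (c→x j cj≡a))
    ; from∘to     = λ i xi≡a → proj₂ (x→c i xi≡a)
    ; to∘from     = λ j cj≡a → proj₂ (c→x j cj≡a) }
    where
    x≡uc′ = lookup-⋆ (proj₁ u) (proj₁ c) (cong proj₁ x≡uc)
    c≡vx′ = lookup-⋆ (proj₁ v) (proj₁ x) (cong proj₁ c≡vx)
    x→c = λ i {a} xi≡a → cellClass-L (proj₁ x) (proj₁ c) (proj₁ u) (proj₁ v) (toWitness (proj₂ x))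
                           x≡uc′ c≡vx′ i {a} (lookup-classes⇒cellClass x i xi≡a)
    c→x = λ j {a} cj≡a → cellClass-L (proj₁ c) (proj₁ x) (proj₁ v) (proj₁ u) (toWitness (proj₂ c))
                           c≡vx′ x≡uc′ j {a} (lookup-classes⇒cellClass c j cj≡a)

  classW-L : ∀ {x c} → x ≼L c → c ≼L x → classW x ≡ classW c
  classW-L {x} {c} x≼c c≼x = count≡⇒classW≡ x c (Matching⇒count≡ (L-matching x≼c c≼x))

  module Representative (k : Fin (boundedVecs n d)) where

    colouring : PColouring n d
    colouring = realise n d (decode n d k)

    representative : W
    representative = element (restrict id colouring) (λ j → M.maybe rep one (lookup colouring j))
                             (Inj-restrict id id colouring λ _ _ → refl)

    classes-representative : classes representative ≡ colouring
    classes-representative = lookup-ext λ j → begin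
      lookup (classes representative) j
        ≡⟨ lookup-classes representative j ⟩
      cellClass (lookup (assemble (restrict id colouring) _) j)
        ≡⟨ cong cellClass (lookup-assemble (restrict id colouring) _ j) ⟩
      cellClass (M.map _ (lookup (restrict id colouring) j))
        ≡⟨ cong (cellClass ∘ M.map _) (lookup-restrict id colouring j) ⟩
      cellClass (M.map _ (M.map _ (lookup colouring j)))
        ≡⟨ class-of-rep (lookup colouring j) ⟩
      lookup colouring j ∎
      where
      open ≡-Reasoning
      class-of-rep : ∀ {j} w → cellClass (M.map (_, M.maybe rep one w) (M.map (λ _ → j) w)) ≡ w
      class-of-rep nothing  = refl
      class-of-rep (just z) = cong just (class-rep z)

    classW-representative : classW representative ≡ k
    classW-representative =
      trans (encode-cong (trans (cong counts classes-representative)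
                                (counts-realise n d (decode n d k) (decode-bounded n d k)))
                         _ (decode-bounded n d k))
            (encode-decode n d k)

  lookup-classes-shape : ∀ x i {m} → lookup (shape′ (proj₁ x)) i ≡ just m →
    lookup (classes x) i ≡ just (class (label (proj₁ x) i))
  lookup-classes-shape x i xi≡m =
    trans (lookup-classes x i) (cell (lookup (proj₁ x) i) (trans (sym (lookup-shape (proj₁ x) i)) xi≡m))
    where
    cell : ∀ {m} w → M.map proj₁ w ≡ just m → cellClass w ≡ just (class (M.maybe proj₂ one w))
    cell (just _) _ = refl

  lookup-classes⇒shape : ∀ x i {a} → lookup (classes x) i ≡ just a →
    lookup (shape′ (proj₁ x)) i ≡ just (target (shape′ (proj₁ x)) i) × class (label (proj₁ x) i) ≡ a
  lookup-classes⇒shape x i xi≡a with cellClass-just _ (lookup-classes⇒cellClass x i xi≡a)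
  ... | _ , _ , ei≡ms , s~a = trans xi (cong just (sym (target-just (shape′ (proj₁ x)) xi))) ,
                              trans (cong (class ∘ M.maybe proj₂ one) ei≡ms) s~a
    where xi = lookup-shape-just (proj₁ x) i ei≡ms

  module MatchedCells (x y : W) (M : Matching (classes x) (classes y)) where
    open Matching M

    vx vy : PMap d
    vx = shape′ (proj₁ x)
    vy = shape′ (proj₁ y)

    to-cell : ∀ i {m} → lookup vx i ≡ just m →
      lookup vy (to i) ≡ just (target vy (to i)) × from (to i) ≡ i ×
      class (label (proj₁ y) (to i)) ≡ class (label (proj₁ x) i)
    to-cell i xi≡m =
      let x-class = lookup-classes-shape x i xi≡m
          yi , same-class = lookup-classes⇒shape y (to i) (to-colour i x-class)
      in yi , from∘to i x-class , same-class

    carry : PMap d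
    carry = restrict to vx

    carry-inj : Inj carry
    carry-inj = Inj-restrict to from vx λ i xi≡m → proj₁ (proj₂ (to-cell i xi≡m))

    carryImage : PMap d
    carryImage = V.map (M.map (target vy ∘ to)) (inverse vx)

    lookup-carryImage : ∀ m → lookup carryImage m ≡ M.map (target vy ∘ to) (lookup (inverse vx) m)
    lookup-carryImage m = VP.lookup-map m _ (inverse vx)

    carryImage-inj : Inj carryImage
    carryImage-inj = Inj-fromLeftInverse carryImage (λ m′ → target vx (from (target (inverse vy) m′)))
      λ m {m′} c-m≡m′ →
        let i , inv-m≡i , m′≡ = map≡just⇒ (lookup (inverse vx) m) (trans (sym (lookup-carryImage m)) c-m≡m′)
            xi = lookup-inverse⇒ vx inv-m≡i
            yi , from-to , _ = to-cell i xi
        in begin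
          target vx (from (target (inverse vy) m′))
            ≡⟨ cong (λ k → target vx (from (target (inverse vy) k))) m′≡ ⟨
          target vx (from (target (inverse vy) (target vy (to i))))
            ≡⟨ cong (target vx ∘ from) (target-just (inverse vy) (lookup-inverse vy (toWitness (proj₂ y)) yi)) ⟩
          target vx (from (to i))                            ≡⟨ cong (target vx) from-to ⟩
          target vx i                                        ≡⟨ target-just vx xi ⟩
          m                                                  ∎
      where open ≡-Reasoning

  -- c has the domain of y, sends j to the image under x of from j, and carries a label mid j
  -- with lx (from j) L mid j R ly j; then x = u c, c = v x, c = y t and y = c t′.
  module Completion (x y : W) (M : Matching (classes x) (classes y)) where
    open Matching M
    open MatchedCells x y M using (vx; vy; to-cell; carry; carry-inj; carryImage; lookup-carryImage; carryImage-inj)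
    open MatchedCells y x (Matching-sym M) using () renaming
      (to-cell to from-cell; carry to carry′; carry-inj to carry′-inj;
       carryImage to carryImage′; lookup-carryImage to lookup-carryImage′; carryImage-inj to carryImage′-inj)

    lx ly : Fin d → C
    lx = label (proj₁ x)
    ly = label (proj₁ y)

    x-inj : Inj vx
    x-inj = toWitness (proj₂ x)

    y-inj : Inj vy
    y-inj = toWitness (proj₂ y)

    bridgeAt : ∀ j → Maybe (Bridge (lx (from j)) (ly j))
    bridgeAt j = bridge? (lx (from j)) (ly j)

    bridgeAt-law : ∀ j {m} → lookup vy j ≡ just m →
      (P : Maybe (Bridge (lx (from j)) (ly j)) → Set) → (∀ B → P (just B)) → P (bridgeAt j)
    bridgeAt-law j yj≡m P holds =
      let B , bridge≡B = bridge?-just (proj₂ (proj₂ (from-cell j yj≡m))) in subst P (sym bridge≡B) (holds B)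

    mid α β γ δ : Fin d → C
    mid j = M.maybe Bridge.mid one (bridgeAt j)
    α   j = M.maybe Bridge.α   one (bridgeAt j)
    β   j = M.maybe Bridge.β   one (bridgeAt j)
    γ   j = M.maybe Bridge.γ   one (bridgeAt j)
    δ   j = M.maybe Bridge.δ   one (bridgeAt j)

    vc : PMap d
    vc = restrict (target vx ∘ from) vy

    inverse-x-from : ∀ j {m} → lookup vy j ≡ just m → lookup (inverse vx) (target vx (from j)) ≡ just (from j)
    inverse-x-from j yj≡m = lookup-inverse vx x-inj (proj₁ (from-cell j yj≡m))

    vc-inj : Inj vc
    vc-inj = Inj-restrict (target vx ∘ from) (to ∘ target (inverse vx)) vy λ j yj≡m →
      trans (cong to (target-just (inverse vx) (inverse-x-from j yj≡m))) (proj₁ (proj₂ (from-cell j yj≡m)))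

    c u v t t′ : W
    c  = element vc mid vc-inj
    u  = element carry (α ∘ to) carry-inj
    v  = element carry′ β carry′-inj
    t  = element carryImage′ (γ ∘ target (inverse vy)) carryImage′-inj
    t′ = element carryImage (δ ∘ to ∘ target (inverse vx)) carryImage-inj

    lx-from≡α·mid : ∀ j {m} → lookup vy j ≡ just m → lx (from j) ≡ α j · mid j
    lx-from≡α·mid j yj≡m =
      bridgeAt-law j yj≡m (λ b → lx (from j) ≡ M.maybe Bridge.α one b · M.maybe Bridge.mid one b) Bridge.a≡α·mid

    mid≡β·lx-from : ∀ j {m} → lookup vy j ≡ just m → mid j ≡ β j · lx (from j)
    mid≡β·lx-from j yj≡m =
      bridgeAt-law j yj≡m (λ b → M.maybe Bridge.mid one b ≡ M.maybe Bridge.β one b · lx (from j)) Bridge.mid≡β·a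

    mid≡ly·γ : ∀ j {m} → lookup vy j ≡ just m → mid j ≡ ly j · γ j
    mid≡ly·γ j yj≡m =
      bridgeAt-law j yj≡m (λ b → M.maybe Bridge.mid one b ≡ ly j · M.maybe Bridge.γ one b) Bridge.mid≡b·γ

    ly≡mid·δ : ∀ j {m} → lookup vy j ≡ just m → ly j ≡ mid j · δ j
    ly≡mid·δ j yj≡m =
      bridgeAt-law j yj≡m (λ b → ly j ≡ M.maybe Bridge.mid one b · M.maybe Bridge.δ one b) Bridge.b≡mid·δ

    x≡u⊙c : x ≡ u ⊙ c
    x≡u⊙c = W-≡ (begin
      proj₁ x
        ≡⟨ assemble-shape-label (proj₁ x) ⟩
      assemble vx lx
        ≡⟨ assemble-cong vx (carry ⨾ vc) same-shape same-label ⟩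
      assemble (carry ⨾ vc) (λ i → α (to i) · mid (target carry i))
        ≡⟨ assemble-⋆ carry (α ∘ to) vc mid ⟨
      proj₁ (u ⊙ c) ∎)
      where
      open ≡-Reasoning
      same-shape : ∀ i → lookup vx i ≡ lookup (carry ⨾ vc) i
      same-shape = by-domain vx
        (λ i xi≡∅ → trans xi≡∅ (sym (trans (lookup-⨾ carry vc i)
                      (cong (_>>= lookup vc) (lookup-restrict-nothing to vx i xi≡∅)))))
        (λ i xi≡m → let yti , from-to , _ = to-cell i xi≡m in sym (begin
          lookup (carry ⨾ vc) i          ≡⟨ lookup-⨾ carry vc i ⟩
          (lookup carry i >>= lookup vc) ≡⟨ cong (_>>= lookup vc) (lookup-restrict-just to vx i xi≡m) ⟩
          lookup vc (to i)               ≡⟨ lookup-restrict-just _ vy (to i) yti ⟩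
          just (target vx (from (to i))) ≡⟨ cong (just ∘ target vx) from-to ⟩
          just (target vx i)             ≡⟨ cong just (target-just vx xi≡m) ⟩
          just _                         ≡⟨ xi≡m ⟨
          lookup vx i                    ∎))
      same-label : ∀ i {m} → lookup vx i ≡ just m → lx i ≡ α (to i) · mid (target carry i)
      same-label i xi≡m = let yti , from-to , _ = to-cell i xi≡m in begin
        lx i                            ≡⟨ cong lx from-to ⟨
        lx (from (to i))                ≡⟨ lx-from≡α·mid (to i) yti ⟩
        α (to i) · mid (to i)
          ≡⟨ cong (λ k → α (to i) · mid k) (target-just carry (lookup-restrict-just to vx i xi≡m)) ⟨
        α (to i) · mid (target carry i) ∎

    c≡v⊙x : c ≡ v ⊙ x
    c≡v⊙x = W-≡ (begin
      assemble vc mid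
        ≡⟨ assemble-cong vc (carry′ ⨾ vx) same-shape same-label ⟩
      assemble (carry′ ⨾ vx) (λ j → β j · lx (target carry′ j))
        ≡⟨ assemble-⋆ carry′ β vx lx ⟨
      assemble carry′ β ⋆′ assemble vx lx
        ≡⟨ cong (assemble carry′ β ⋆′_) (assemble-shape-label (proj₁ x)) ⟨
      proj₁ (v ⊙ x) ∎)
      where
      open ≡-Reasoning
      same-shape : ∀ j → lookup vc j ≡ lookup (carry′ ⨾ vx) j
      same-shape = by-domain vy
        (λ j yj≡∅ → trans (lookup-restrict-nothing _ vy j yj≡∅) (sym (trans (lookup-⨾ carry′ vx j)
                      (cong (_>>= lookup vx) (lookup-restrict-nothing from vy j yj≡∅)))))
        (λ j yj≡m → trans (lookup-restrict-just _ vy j yj≡m) (sym (trans (lookup-⨾ carry′ vx j)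
                      (trans (cong (_>>= lookup vx) (lookup-restrict-just from vy j yj≡m)) (proj₁ (from-cell j yj≡m))))))
      same-label : ∀ j {m} → lookup vc j ≡ just m → mid j ≡ β j · lx (target carry′ j)
      same-label j cj≡m = let _ , yj≡a = lookup-restrict⇒ _ vy j cj≡m in
        trans (mid≡β·lx-from j yj≡a)
              (cong (λ k → β j · lx k) (sym (target-just carry′ (lookup-restrict-just from vy j yj≡a))))

    c≡y⊙t : c ≡ y ⊙ t
    c≡y⊙t = W-≡ (begin
      assemble vc mid                    ≡⟨ assemble-cong vc (vy ⨾ carryImage′) same-shape same-label ⟩
      assemble (vy ⨾ carryImage′) _     ≡⟨ assemble-⋆ vy ly carryImage′ (γ ∘ target (inverse vy)) ⟨
      assemble vy ly ⋆′ assemble carryImage′ (γ ∘ target (inverse vy))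
        ≡⟨ cong (_⋆′ assemble carryImage′ (γ ∘ target (inverse vy))) (assemble-shape-label (proj₁ y)) ⟨
      proj₁ (y ⊙ t)                      ∎)
      where
      open ≡-Reasoning
      same-shape : ∀ j → lookup vc j ≡ lookup (vy ⨾ carryImage′) j
      same-shape = by-domain vy
        (λ j yj≡∅ → trans (lookup-restrict-nothing _ vy j yj≡∅)
                      (sym (trans (lookup-⨾ vy carryImage′ j) (cong (_>>= lookup carryImage′) yj≡∅))))
        (λ j yj≡m → trans (lookup-restrict-just _ vy j yj≡m) (sym (begin
          lookup (vy ⨾ carryImage′) j                      ≡⟨ lookup-⨾ vy carryImage′ j ⟩
          (lookup vy j >>= lookup carryImage′)             ≡⟨ cong (_>>= lookup carryImage′) yj≡m ⟩
          lookup carryImage′ _                             ≡⟨ lookup-carryImage′ _ ⟩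
          M.map (target vx ∘ from) (lookup (inverse vy) _) ≡⟨ cong (M.map _) (lookup-inverse vy y-inj yj≡m) ⟩
          just (target vx (from j))                        ∎)))
      same-label : ∀ j {m} → lookup vc j ≡ just m → mid j ≡ ly j · γ (target (inverse vy) (target vy j))
      same-label j cj≡m = let _ , yj≡a = lookup-restrict⇒ _ vy j cj≡m in
        trans (mid≡ly·γ j yj≡a) (cong (λ k → ly j · γ k) (sym (trans (cong (target (inverse vy)) (target-just vy yj≡a))
                                                                    (target-just (inverse vy) (lookup-inverse vy y-inj yj≡a)))))

    y≡c⊙t′ : y ≡ c ⊙ t′
    y≡c⊙t′ = W-≡ (begin
      proj₁ y                      ≡⟨ assemble-shape-label (proj₁ y) ⟩
      assemble vy ly               ≡⟨ assemble-cong vy (vc ⨾ carryImage) same-shape same-label ⟩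
      assemble (vc ⨾ carryImage) _ ≡⟨ assemble-⋆ vc mid carryImage (δ ∘ to ∘ target (inverse vx)) ⟨
      proj₁ (c ⊙ t′)               ∎)
      where
      open ≡-Reasoning
      same-shape : ∀ j → lookup vy j ≡ lookup (vc ⨾ carryImage) j
      same-shape = by-domain vy
        (λ j yj≡∅ → trans yj≡∅ (sym (trans (lookup-⨾ vc carryImage j)
                      (cong (_>>= lookup carryImage) (lookup-restrict-nothing _ vy j yj≡∅)))))
        (λ j yj≡m → let _ , to-from , _ = from-cell j yj≡m in sym (begin
          lookup (vc ⨾ carryImage) j                                        ≡⟨ lookup-⨾ vc carryImage j ⟩
          (lookup vc j >>= lookup carryImage)
            ≡⟨ cong (_>>= lookup carryImage) (lookup-restrict-just _ vy j yj≡m) ⟩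
          lookup carryImage (target vx (from j))                            ≡⟨ lookup-carryImage _ ⟩
          M.map (target vy ∘ to) (lookup (inverse vx) (target vx (from j))) ≡⟨ cong (M.map _) (inverse-x-from j yj≡m) ⟩
          just (target vy (to (from j)))                                    ≡⟨ cong (just ∘ target vy) to-from ⟩
          just (target vy j)                                                ≡⟨ cong just (target-just vy yj≡m) ⟩
          just _                                                            ≡⟨ yj≡m ⟨
          lookup vy j                                                       ∎))
      same-label : ∀ j {m} → lookup vy j ≡ just m → ly j ≡ mid j · δ (to (target (inverse vx) (target vc j)))
      same-label j yj≡m = let _ , to-from , _ = from-cell j yj≡m in
        trans (ly≡mid·δ j yj≡m) (cong (λ k → mid j · δ k) (sym (begin
          to (target (inverse vx) (target vc j))
            ≡⟨ cong (to ∘ target (inverse vx)) (target-just vc (lookup-restrict-just _ vy j yj≡m)) ⟩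
          to (target (inverse vx) (target vx (from j))) ≡⟨ cong to (target-just (inverse vx) (inverse-x-from j yj≡m)) ⟩
          to (from j)                                   ≡⟨ to-from ⟩
          j                                             ∎)))

  wreathClassification : DClassification (Wr S d) (boundedVecs n d)
  wreathClassification = record
    { one       = unit
    ; identityˡ = unit-identityˡ
    ; identityʳ = unit-identityʳ
    ; class     = classW
    ; rep       = Representative.representative
    ; class-rep = Representative.classW-representative
    ; class-L   = classW-L
    ; class-R   = classW-R
    ; class≡⇒LR = λ {x} {y} x~y →
        let open Completion x y (count≡⇒Matching _ _ (classW≡⇒count≡ x y x~y))
        in c , ((u , x≡u⊙c) , (v , c≡v⊙x)) , ((t , c≡y⊙t) , (t′ , y≡c⊙t′)) }

-- Iterated wreath products of IS_d

trivialMagma : RawMagma 0ℓ 0ℓ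
trivialMagma = record { Carrier = ⊤ ; _≈_ = _≡_ ; _∙_ = λ _ _ → tt }

trivialClassification : DClassification trivialMagma 1
trivialClassification = record
  { one = tt ; identityˡ = λ _ → refl ; identityʳ = λ _ → refl
  ; class = λ _ → zero ; rep = λ _ → tt ; class-rep = λ { zero → refl }
  ; class-L = λ _ _ → refl ; class-R = λ _ _ → refl
  ; class≡⇒LR = λ _ → tt , ((tt , refl) , (tt , refl)) , ((tt , refl) , (tt , refl)) }

module SymmetricInverseAsWreath (d : ℕ) where
  open RawMagma (Wr trivialMagma d) using () renaming (Carrier to W; _∙_ to _⊙_)
  open RawMagma (IS d) using () renaming (Carrier to I; _∙_ to _·_)

  shapeᵗ : WVec trivialMagma d → PMap d
  shapeᵗ = shape trivialMagma d

  labelTrivially : PMap d → WVec trivialMagma d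
  labelTrivially = V.map (M.map (_, tt))

  lookup-shape-labelTrivially : ∀ v i → lookup (shapeᵗ (labelTrivially v)) i ≡ lookup v i
  lookup-shape-labelTrivially v i = begin
    lookup (shapeᵗ (labelTrivially v)) i       ≡⟨ VP.lookup-map i _ (labelTrivially v) ⟩
    M.map proj₁ (lookup (labelTrivially v) i)  ≡⟨ cong (M.map proj₁) (VP.lookup-map i _ v) ⟩
    M.map proj₁ (M.map (_, tt) (lookup v i))   ≡⟨ MP.map-∘ (lookup v i) ⟨
    M.map id (lookup v i)                      ≡⟨ MP.map-id (lookup v i) ⟩
    lookup v i                                 ∎
    where open ≡-Reasoning

  withTrivialLabels : I → W
  withTrivialLabels (v , v-inj) = labelTrivially v ,
    fromWitness (Inj-resp v (shapeᵗ (labelTrivially v)) (λ i → sym (lookup-shape-labelTrivially v i))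
                          (toWitness v-inj))

  unlabel : W → I
  unlabel (e , e-inj) = shapeᵗ e , e-inj

  unlabel∘withTrivialLabels : ∀ a → unlabel (withTrivialLabels a) ≡ a
  unlabel∘withTrivialLabels (v , _) = Σ-True-≡ inj? (lookup-ext (lookup-shape-labelTrivially v))

  withTrivialLabels∘unlabel : ∀ x → withTrivialLabels (unlabel x) ≡ x
  withTrivialLabels∘unlabel (e , _) = Σ-True-≡ (inj? ∘ shapeᵗ) (lookup-ext λ i → begin
    lookup (labelTrivially (shapeᵗ e)) i      ≡⟨ VP.lookup-map i _ (shapeᵗ e) ⟩
    M.map (_, tt) (lookup (shapeᵗ e) i)       ≡⟨ cong (M.map (_, tt)) (VP.lookup-map i _ e) ⟩
    M.map (_, tt) (M.map proj₁ (lookup e i))  ≡⟨ MP.map-∘ (lookup e i) ⟨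
    M.map id (lookup e i)                     ≡⟨ MP.map-id (lookup e i) ⟩
    lookup e i                                ∎)
    where open ≡-Reasoning

  unlabel-hom : ∀ x y → unlabel (x ⊙ y) ≡ unlabel x · unlabel y
  unlabel-hom (e , _) (e′ , _) = Σ-True-≡ inj? (lookup-ext (shape-⋆ trivialMagma d e e′))

  symmetricInverseClassification : DClassification (IS d) (boundedVecs 1 d)
  symmetricInverseClassification =
    Transport.transported (WreathClassification.wreathClassification trivialClassification d)
      withTrivialLabels unlabel unlabel∘withTrivialLabels withTrivialLabels∘unlabel unlabel-hom

wrPowClassification : ∀ d k → DClassification (WrPow d (suc k)) (iterate (P d) (suc k) 1)
wrPowClassification d zero = subst (DClassification (IS d)) (boundedVecs≡binomial 1 d)
  (SymmetricInverseAsWreath.symmetricInverseClassification d)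
wrPowClassification d (suc k) = subst (DClassification (WrPow d (suc (suc k)))) (boundedVecs≡binomial _ d)
  (WreathClassification.wreathClassification (wrPowClassification d k) d)

mainTheorem8 : (d k : ℕ) → 1 ≤ d → 1 ≤ k →
    NumberOfDClasses (WrPow d k) (iterate (P d) k 1)
mainTheorem8 d (suc k) _ _ = DClassification⇒NumberOfDClasses (wrPowClassification d k)
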